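{- Let $3\le p<q$ be relatively prime integers, let $s$ be an integer with $3\le s<q$ and $\gcd(s,pq)=1$, and put $r=pq+s$. For all integers $k,j,\beta$ with $|k|<pq$, $0<|j|<s$, and $|\beta|\le\lfloor pq/s\rfloor$, \[ \chi(kr+j+\beta pq)=\chi(kr+j). \]
   Context: Every integer $n$ has a unique representation $n=x_nqr+y_nrp+z_npq+\delta_npqr$ with $0\le x_n<p$, $0\le y_n<q$, $0\le z_n<r$, $\delta_n\in\mathbb Z$; $n$ is called representable if $\delta_n\ge 0$, and $\chi(n)$ is $1$ if $n$ is representable and $0$ otherwise. -}

module Defs where

open import Data.Nat using (ℕ; _<_)
import Data.Nat as ℕ
open import Data.Integer using (ℤ; +_; _+_; _*_; _≤_)
open import Data.Product using (Σ; _×_)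
open import Relation.Binary.PropositionalEquality using (_≡_)

-- A representation of the integer n with respect to (p, q, r):
--   n = x*q*r + y*r*p + z*p*q + δ*p*q*r,  0 ≤ x < p, 0 ≤ y < q, 0 ≤ z < r, δ ∈ ℤ.
-- (For pairwise coprime p q r this representation exists and is unique.)
record Representation (p q r : ℕ) (n : ℤ) : Set where
  constructor rep
  field
    x : ℕ
    y : ℕ
    z : ℕ
    δ : ℤ
    x<p : x < p
    y<q : y < q
    z<r : z < r
    eqn : n ≡ (+ (x ℕ.* q ℕ.* r) + + (y ℕ.* r ℕ.* p) + + (z ℕ.* p ℕ.* q))
              + δ * + (p ℕ.* q ℕ.* r)

Representable : (p q r : ℕ) → ℤ → Set
Representable p q r n = Σ (Representation p q r n) λ R → + 0 ≤ Representation.δ R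

module Submission where

-- Put r = pq + s and b = ⌊pq/s⌋, so that b·s ≤ pq.  In a representation
-- n = x·qr + y·rp + z·pq + δ·pqr every term except z·pq is a multiple of r, and
-- pq ≡ -s (mod r); hence n + z·s ≡ 0 (mod r).  For n = kr + j + γ·pq this says that
-- w = z - γ solves  w·s + j ≡ 0 (mod r).  Since 0 < |j| < s and b·s ≤ pq, no solution
-- has |w| ≤ b (window lemma), and by translating by r neither does any w with
-- |w - r| ≤ b.  So if |γ| ≤ b, then w lies in [b, r - b), and for every γ' with
-- |γ'| ≤ b the digit z' = w + γ' still lies in [0, r).  Replacing z by z' (keeping
-- x, y, δ) is then a representation of kr + j + γ'·pq with the same δ.  Applying
-- this shift with (γ, γ') = (β, 0) and (0, β) gives both directions of lemma9.

open import Defs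
open import Data.Nat using (ℕ; NonZero; zero; suc; z≤n; s≤s) renaming (_<_ to _<ℕ_; _≤_ to _≤ℕ_; _+_ to _+ℕ_; _*_ to _*ℕ_)
import Data.Nat.Properties as ℕ
open import Data.Nat.DivMod using (_/_; m/n*n≤m)
open import Data.Nat.Coprimality using (Coprime)
open import Data.Integer using (ℤ; +_; -[1+_]; _+_; _*_; _-_; -_; ∣_∣; 0ℤ; _≤_; _<_; +≤+; -≤-; -≤+; +<+; _≤?_; _<?_)
open import Data.Integer.Properties
open import Data.Integer.Tactic.RingSolver using (solve; solve-∀)
open import Algebra.Bundles using (AbelianGroup)
open import Algebra.Properties.Group (AbelianGroup.group +-0-abelianGroup) using (inverseʳ-unique)
open import Data.List using ([]; _∷_)
open import Data.Product using (_×_; _,_)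
open import Data.Empty using (⊥-elim)
open import Function.Bundles using (_⇔_; mk⇔)
open import Relation.Binary.PropositionalEquality
open import Relation.Nullary using (yes; no)

∣∣≤⇒bounded : ∀ {i n} → ∣ i ∣ ≤ℕ n → - + n ≤ i × i ≤ + n
∣∣≤⇒bounded {+ m}                   m≤n       = neg-≤-pos , +≤+ m≤n
∣∣≤⇒bounded { -[1+ m ]} {suc n}     (s≤s m≤n) = -≤- m≤n , -≤+

bounded⇒∣∣≤ : ∀ {i n} → - + n ≤ i → i ≤ + n → ∣ i ∣ ≤ℕ n
bounded⇒∣∣≤ {+ m}                   _         (+≤+ m≤n) = m≤n
bounded⇒∣∣≤ { -[1+ m ]} {zero}      ()        _
bounded⇒∣∣≤ { -[1+ m ]} {suc n}     (-≤- m≤n) _         = s≤s m≤n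

small-multiple : ∀ c R → ∣ c * + R ∣ <ℕ R → c ≡ 0ℤ
small-multiple c R small = ∣i∣≡0⇒i≡0 (ℕ.n<1⇒n≡0 (ℕ.*-cancelʳ-< R ∣ c ∣ 1 ∣c∣R<1R))
  where
  ∣c∣R<1R : ∣ c ∣ *ℕ R <ℕ 1 *ℕ R
  ∣c∣R<1R = subst₂ _<ℕ_ (abs-* c (+ R)) (sym (ℕ.*-identityˡ R)) small

-- Window lemma.  If B·S ≤ P and 0 < |j| < S, then w·S + j is not a multiple of P + S
-- for any |w| ≤ B: it is too small to be a nonzero multiple, and it is not 0 since
-- S does not divide j.
off-multiple : ∀ P S B (w j c : ℤ) → B *ℕ S ≤ℕ P → 0 <ℕ ∣ j ∣ → ∣ j ∣ <ℕ S →
               ∣ w ∣ ≤ℕ B → w * + S + j ≢ c * + (P +ℕ S)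
off-multiple P S B w j c BS≤P 0<∣j∣ ∣j∣<S ∣w∣≤B wS+j≡cR =
  ℕ.<⇒≢ 0<∣j∣ (sym (cong ∣_∣ j≡0))
  where
  open ℕ.≤-Reasoning
  small : ∣ w * + S + j ∣ <ℕ P +ℕ S
  small = begin-strict
    ∣ w * + S + j ∣      ≤⟨ ∣i+j∣≤∣i∣+∣j∣ (w * + S) j ⟩
    ∣ w * + S ∣ +ℕ ∣ j ∣ ≡⟨ cong (_+ℕ ∣ j ∣) (abs-* w (+ S)) ⟩
    ∣ w ∣ *ℕ S +ℕ ∣ j ∣  <⟨ ℕ.+-mono-≤-< (ℕ.*-monoˡ-≤ S ∣w∣≤B) ∣j∣<S ⟩
    B *ℕ S +ℕ S          ≤⟨ ℕ.+-monoˡ-≤ S BS≤P ⟩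
    P +ℕ S               ∎
  c≡0 : c ≡ 0ℤ
  c≡0 = small-multiple c (P +ℕ S) (subst (λ t → ∣ t ∣ <ℕ P +ℕ S) wS+j≡cR small)
  j≡-wS : j ≡ - (w * + S)
  j≡-wS = inverseʳ-unique (w * + S) j (trans wS+j≡cR (cong (_* + (P +ℕ S)) c≡0))
  w≡0 : w ≡ 0ℤ
  w≡0 = small-multiple w S (subst (_<ℕ S) (trans (cong ∣_∣ j≡-wS) (∣-i∣≡∣i∣ (w * + S))) ∣j∣<S)
  j≡0 : j ≡ 0ℤ
  j≡0 = trans j≡-wS (cong (λ t → - (t * + S)) w≡0)

near : ∀ {w R b} → R ≤ w + b → w < R + b → - b ≤ w - R × w - R < b
near {w} {R} {b} R≤w+b w<R+b =
  subst₂ _≤_ lower-end upper-end (+-monoˡ-≤ (- R - b) R≤w+b) ,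
  subst (w - R <_) b-end (+-monoˡ-< (- R) w<R+b)
  where
  lower-end : R + (- R - b) ≡ - b
  lower-end = solve (R ∷ b ∷ [])
  upper-end : w + b + (- R - b) ≡ w - R
  upper-end = solve (w ∷ R ∷ b ∷ [])
  b-end : R + b - R ≡ b
  b-end = solve (R ∷ b ∷ [])

translate-solution : ∀ w j c S R → w * S + j ≡ c * R → (w - R) * S + j ≡ (c - S) * R
translate-solution w j c S R wS+j≡cR = begin
  (w - R) * S + j     ≡⟨ solve (w ∷ j ∷ S ∷ R ∷ []) ⟩
  (w * S + j) - R * S ≡⟨ cong (_- R * S) wS+j≡cR ⟩
  c * R - R * S       ≡⟨ solve (c ∷ S ∷ R ∷ []) ⟩
  (c - S) * R         ∎
  where open ≡-Reasoning

-- A solution w of  w·S + j ≡ 0 (mod P + S)  in the range [-B, P + S + B) lies in fact in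
-- [B, P + S - B): the two excluded ends are windows around 0 and around P + S.
residue-window : ∀ P S B (w j c : ℤ) → B *ℕ S ≤ℕ P → 0 <ℕ ∣ j ∣ → ∣ j ∣ <ℕ S →
                 w * + S + j ≡ c * + (P +ℕ S) → - + B ≤ w → w < + (P +ℕ S) + + B →
                 + B ≤ w × w + + B < + (P +ℕ S)
residue-window P S B w j c BS≤P 0<∣j∣ ∣j∣<S wS+j≡cR -B≤w w<R+B = B≤w , w+B<R
  where
  excluded : ∀ v d → ∣ v ∣ ≤ℕ B → v * + S + j ≢ d * + (P +ℕ S)
  excluded v d = off-multiple P S B v j d BS≤P 0<∣j∣ ∣j∣<S
  B≤w : + B ≤ w
  B≤w with + B ≤? w
  ... | yes B≤w = B≤w
  ... | no  B≰w = ⊥-elim (excluded w c (bounded⇒∣∣≤ -B≤w (<⇒≤ (≰⇒> B≰w))) wS+j≡cR)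
  w+B<R : w + + B < + (P +ℕ S)
  w+B<R with w + + B <? + (P +ℕ S)
  ... | yes w+B<R = w+B<R
  ... | no  w+B≮R with near (≮⇒≥ w+B≮R) w<R+B
  ...   | lower , upper = ⊥-elim (excluded (w - + (P +ℕ S)) (c - + S) (bounded⇒∣∣≤ lower (<⇒≤ upper))
                                    (translate-solution w j c (+ S) (+ (P +ℕ S)) wS+j≡cR))

value : (p q r x y z : ℕ) → ℤ → ℤ
value p q r x y z δ = (+ (x *ℕ q *ℕ r) + + (y *ℕ r *ℕ p) + + (z *ℕ p *ℕ q)) + δ * + (p *ℕ q *ℕ r)

pos-*³ : ∀ a b c → + (a *ℕ b *ℕ c) ≡ + a * + b * + c
pos-*³ a b c = trans (pos-* (a *ℕ b) c) (cong (_* + c) (pos-* a b))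

z-term : ∀ p q z → + (z *ℕ p *ℕ q) ≡ + z * + (p *ℕ q)
z-term p q z = trans (cong +_ (ℕ.*-assoc z p q)) (pos-* z (p *ℕ q))

value-shift : ∀ p q r x y z z′ δ t → + z′ ≡ + z + t →
              value p q r x y z′ δ ≡ value p q r x y z δ + t * + (p *ℕ q)
value-shift p q r x y z z′ δ t z′≡z+t = begin
  (X + Y + + (z′ *ℕ p *ℕ q)) + D  ≡⟨ cong (λ u → (X + Y + u) + D) z′-term ⟩
  (X + Y + (Z + t * PQ)) + D       ≡⟨ regroup X Y Z D (t * PQ) ⟩
  (X + Y + Z) + D + t * PQ         ∎
  where
  open ≡-Reasoning
  X Y Z D PQ : ℤ
  X = + (x *ℕ q *ℕ r)
  Y = + (y *ℕ r *ℕ p)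
  Z = + (z *ℕ p *ℕ q)
  D = δ * + (p *ℕ q *ℕ r)
  PQ = + (p *ℕ q)
  z′-term : + (z′ *ℕ p *ℕ q) ≡ Z + t * PQ
  z′-term = begin
    + (z′ *ℕ p *ℕ q)      ≡⟨ z-term p q z′ ⟩
    + z′ * PQ             ≡⟨ cong (_* PQ) z′≡z+t ⟩
    (+ z + t) * PQ        ≡⟨ *-distribʳ-+ PQ (+ z) t ⟩
    + z * PQ + t * PQ     ≡⟨ cong (_+ t * PQ) (z-term p q z) ⟨
    Z + t * PQ            ∎
  regroup : ∀ a b c d e → (a + b + (c + e)) + d ≡ (a + b + c) + d + e
  regroup = solve-∀

-- For r = pq + s the value is congruent to -z·s modulo r: every term but z·pq is a
-- multiple of r, and pq = r - s.
value-mod : ∀ p q s x y z δ →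
            value p q (p *ℕ q +ℕ s) x y z δ + + z * + s
            ≡ (+ x * + q + + y * + p + + z + δ * + (p *ℕ q)) * + (p *ℕ q +ℕ s)
value-mod p q s x y z δ = begin
  value p q r x y z δ + Z * S                              ≡⟨ cong (_+ Z * S) in-ℤ ⟩
  (X * Q * R + Y * R * P + Z * PQ) + δ * (PQ * R) + Z * S  ≡⟨ expand X Q Y P Z δ PQ S ⟩
  (X * Q + Y * P + Z + δ * PQ) * R                         ∎
  where
  open ≡-Reasoning
  r : ℕ
  r = p *ℕ q +ℕ s
  P Q S R PQ X Y Z : ℤ
  P = + p
  Q = + q
  S = + s
  R = + r
  PQ = + (p *ℕ q)
  X = + x
  Y = + y
  Z = + z
  -- the value with all products taken in ℤ; note that R = PQ + S holds definitionally
  in-ℤ : value p q r x y z δ ≡ (X * Q * R + Y * R * P + Z * PQ) + δ * (PQ * R)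
  in-ℤ = cong₂ _+_ (cong₂ _+_ (cong₂ _+_ (pos-*³ x q r) (pos-*³ y r p)) (z-term p q z))
                   (cong (δ *_) (pos-* (p *ℕ q) r))
  expand : ∀ X Q Y P Z D PQ S →
           (X * Q * (PQ + S) + Y * (PQ + S) * P + Z * PQ) + D * (PQ * (PQ + S)) + Z * S
           ≡ (X * Q + Y * P + Z + D * PQ) * (PQ + S)
  expand = solve-∀

-- If n = k·R + j + γ·PQ with R = PQ + S, and n + z·S = C·R, then w = z - γ solves
-- w·S + j ≡ 0 (mod R), because γ·PQ = γ·R - γ·S.
digit-congruence : ∀ n k j γ z C PQ S → n ≡ k * (PQ + S) + j + γ * PQ → n + z * S ≡ C * (PQ + S) →
                   (z - γ) * S + j ≡ (C - k - γ) * (PQ + S)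
digit-congruence n k j γ z C PQ S n≡ n+zS≡CR = begin
  (z - γ) * S + j
    ≡⟨ solve (k ∷ j ∷ γ ∷ z ∷ PQ ∷ S ∷ []) ⟩
  (k * (PQ + S) + j + γ * PQ) + z * S - (k + γ) * (PQ + S)
    ≡⟨ cong (λ m → m + z * S - (k + γ) * (PQ + S)) n≡ ⟨
  n + z * S - (k + γ) * (PQ + S)
    ≡⟨ cong (_- (k + γ) * (PQ + S)) n+zS≡CR ⟩
  C * (PQ + S) - (k + γ) * (PQ + S)
    ≡⟨ solve (k ∷ γ ∷ C ∷ PQ ∷ S ∷ []) ⟩
  (C - k - γ) * (PQ + S)
    ∎
  where open ≡-Reasoning

digit-range : ∀ p q s b k j γ {n} → b *ℕ s ≤ℕ p *ℕ q → 0 <ℕ ∣ j ∣ → ∣ j ∣ <ℕ s → ∣ γ ∣ ≤ℕ b →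
              n ≡ k * + (p *ℕ q +ℕ s) + j + γ * + (p *ℕ q) →
              (ρ : Representation p q (p *ℕ q +ℕ s) n) →
              + b ≤ + Representation.z ρ - γ × + Representation.z ρ - γ + + b < + (p *ℕ q +ℕ s)
digit-range p q s b k j γ {n} bs≤pq 0<∣j∣ ∣j∣<s ∣γ∣≤b n≡ (rep x y z δ _ _ z<r eqn)
  with ∣∣≤⇒bounded ∣γ∣≤b
... | -b≤γ , γ≤b =
  residue-window (p *ℕ q) s b (+ z - γ) j (C - k - γ) bs≤pq 0<∣j∣ ∣j∣<s congruence -b≤w w<r+b
  where
  C : ℤ
  C = + x * + q + + y * + p + + z + δ * + (p *ℕ q)
  congruence : (+ z - γ) * + s + j ≡ (C - k - γ) * + (p *ℕ q +ℕ s)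
  congruence = digit-congruence n k j γ (+ z) C (+ (p *ℕ q)) (+ s) n≡
                 (trans (cong (_+ + z * + s) eqn) (value-mod p q s x y z δ))
  -b≤w : - + b ≤ + z - γ
  -b≤w = subst (_≤ + z - γ) (+-identityˡ (- + b)) (+-mono-≤ (+≤+ z≤n) (neg-mono-≤ γ≤b))
  w<r+b : + z - γ < + (p *ℕ q +ℕ s) + + b
  w<r+b = +-mono-<-≤ (+<+ z<r) (subst (- γ ≤_) (neg-involutive (+ b)) (neg-mono-≤ -b≤γ))

shift : ∀ p q s b k j γ γ′ {n n′} → b *ℕ s ≤ℕ p *ℕ q → 0 <ℕ ∣ j ∣ → ∣ j ∣ <ℕ s →
        ∣ γ ∣ ≤ℕ b → ∣ γ′ ∣ ≤ℕ b →
        n ≡ k * + (p *ℕ q +ℕ s) + j + γ * + (p *ℕ q) →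
        n′ ≡ k * + (p *ℕ q +ℕ s) + j + γ′ * + (p *ℕ q) →
        Representable p q (p *ℕ q +ℕ s) n → Representable p q (p *ℕ q +ℕ s) n′
shift p q s b k j γ γ′ {n′ = n′} bs≤pq 0<∣j∣ ∣j∣<s ∣γ∣≤b ∣γ′∣≤b n≡ n′≡ (ρ@(rep x y z δ x<p y<q _ eqn) , 0≤δ)
  with digit-range p q s b k j γ bs≤pq 0<∣j∣ ∣j∣<s ∣γ∣≤b n≡ ρ | ∣∣≤⇒bounded ∣γ′∣≤b
... | b≤w , w+b<r | -b≤γ′ , γ′≤b = rep x y ∣ z″ ∣ δ x<p y<q z′<r eqn′ , 0≤δ
  where
  open ≡-Reasoning
  r : ℕ
  r = p *ℕ q +ℕ s
  PQ z″ : ℤ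
  PQ = + (p *ℕ q)
  z″ = + z - γ + γ′
  0≤z″ : 0ℤ ≤ z″
  0≤z″ = subst (_≤ z″) (+-inverseʳ (+ b)) (+-mono-≤ b≤w -b≤γ′)
  z″<r : z″ < + r
  z″<r = ≤-<-trans (+-monoʳ-≤ (+ z - γ) γ′≤b) w+b<r
  z′<r : ∣ z″ ∣ <ℕ r
  z′<r = drop‿+<+ (subst (_< + r) (sym (0≤i⇒+∣i∣≡i 0≤z″)) z″<r)
  z″≡z+Δ : + ∣ z″ ∣ ≡ + z + (γ′ - γ)
  z″≡z+Δ = trans (0≤i⇒+∣i∣≡i 0≤z″) (regroup (+ z) γ γ′)
    where
    regroup : ∀ a g g′ → a - g + g′ ≡ a + (g′ - g)
    regroup = solve-∀
  eqn′ : n′ ≡ value p q r x y ∣ z″ ∣ δ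
  eqn′ = begin
    n′                                      ≡⟨ n′≡ ⟩
    k * + r + j + γ′ * PQ                   ≡⟨ change-coefficient (k * + r + j) γ γ′ PQ ⟩
    (k * + r + j + γ * PQ) + (γ′ - γ) * PQ  ≡⟨ cong (_+ (γ′ - γ) * PQ) (trans (sym n≡) eqn) ⟩
    value p q r x y z δ + (γ′ - γ) * PQ     ≡⟨ value-shift p q r x y z ∣ z″ ∣ δ (γ′ - γ) z″≡z+Δ ⟨
    value p q r x y ∣ z″ ∣ δ                ∎
    where
    change-coefficient : ∀ a g g′ u → a + g′ * u ≡ (a + g * u) + (g′ - g) * u
    change-coefficient = solve-∀

lemma9 : (p q s : ℕ) → 3 ≤ℕ p → p <ℕ q → Coprime p q →
         3 ≤ℕ s → s <ℕ q → Coprime s (p *ℕ q) → .{{_ : NonZero s}} →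
         (k j β : ℤ) → ∣ k ∣ <ℕ p *ℕ q → 0 <ℕ ∣ j ∣ → ∣ j ∣ <ℕ s →
         ∣ β ∣ ≤ℕ (p *ℕ q) / s →
         Representable p q (p *ℕ q +ℕ s) (k * + (p *ℕ q +ℕ s) + j + β * + (p *ℕ q))
           ⇔ Representable p q (p *ℕ q +ℕ s) (k * + (p *ℕ q +ℕ s) + j)
lemma9 p q s _ _ _ _ _ _ k j β _ 0<∣j∣ ∣j∣<s ∣β∣≤b =
  mk⇔ (shift p q s b k j β 0ℤ bs≤pq 0<∣j∣ ∣j∣<s ∣β∣≤b z≤n refl unshifted)
      (shift p q s b k j 0ℤ β bs≤pq 0<∣j∣ ∣j∣<s z≤n ∣β∣≤b unshifted refl)
  where
  b : ℕ
  b = (p *ℕ q) / s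
  bs≤pq : b *ℕ s ≤ℕ p *ℕ q
  bs≤pq = m/n*n≤m (p *ℕ q) s
  unshifted : k * + (p *ℕ q +ℕ s) + j ≡ k * + (p *ℕ q +ℕ s) + j + 0ℤ * + (p *ℕ q)
  unshifted = sym (+-identityʳ _)
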